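{- Every strong model satisfies A3d and A5d: for all $x$ and $\alpha<\kappa$ there is $y$ (denoted $x|^\alpha$) with $x=_\alpha y$ such that $z\sqsubseteq_\alpha x$ implies $z\leq y$ for all $z$; and $x\leq y$ implies $x|^\alpha\leq y|^\alpha$.
   Context: Fix a limit ordinal $\kappa$. A stratified complete lattice is $(L,\leq,(\sqsubseteq_\alpha)_{\alpha<\kappa})$ with $(L,\leq)$ a complete lattice and each $\sqsubseteq_\alpha$ a preorder; $x=_\alpha y$ means $x\sqsubseteq_\alpha y$ and $y\sqsubseteq_\alpha x$. A strong model satisfies: (A1) for $\alpha<\beta<\kappa$, $x\sqsubseteq_\beta y$ implies $x=_\alpha y$; (A2) if $x=_\alpha y$ for all $\alpha$ then $x=y$; (A3) for all $x,\alpha$ there is $y$ with $x=_\alpha y$ such that $x\sqsubseteq_\alpha z$ implies $y\leq z$ (unique, denoted $x|_\alpha$); (A4$^*$) for any index set $I$ and $x_i=_\alpha y_i$ ($i\in I$), $\bigvee_i x_i=_\alpha\bigvee_i y_i$; (A5) $x\leq y$ implies $x|_\alpha\leq y|_\alpha$; (A6) if $x\leq y$ and $x=_\beta y$ for all $\beta<\alpha$ then $x\sqsubseteq_\alpha y$. -}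

module Defs where

open import Level using (Level; _⊔_; suc)
open import Data.Product using (Σ; ∃; _×_; _,_)
open import Relation.Binary.Core using (Rel)
open import Relation.Binary.Definitions using (Transitive; Trichotomous)
open import Relation.Binary.Structures using (IsPartialOrder; IsPreorder)
open import Relation.Binary.PropositionalEquality using (_≡_)
open import Induction.WellFounded using (WellFounded)

-- A limit ordinal κ, presented (up to isomorphism) as the well-ordered set
-- of ordinals α < κ: a strict well-order (well-founded, transitive,
-- trichotomous) which is nonempty (κ ≠ 0) and has no largest element
-- (κ is not a successor).
record LimitOrdinal (o : Level) : Set (suc o) where
  field
    Idx        : Set o
    _<_        : Rel Idx o
    <-wf       : WellFounded _<_
    <-trans    : Transitive _<_
    <-tri      : Trichotomous _≡_ _<_
    nonempty   : Idx
    noMax      : ∀ α → ∃ λ β → α < β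

-- A stratified complete lattice over κ.  (L, ≤) is a complete lattice
-- (partial order w.r.t. propositional equality, with joins ⋁ of arbitrary
-- families indexed by types in Set (o ⊔ c ⊔ ℓ), which covers all subsets
-- of L and of κ), and each ⊑ α is a preorder.
record StratifiedCompleteLattice {o : Level} (κ : LimitOrdinal o) (c ℓ : Level)
       : Set (suc (o ⊔ c ⊔ ℓ)) where
  open LimitOrdinal κ
  field
    Carrier        : Set c
    _≤_            : Rel Carrier ℓ
    ≤-isPartialOrder : IsPartialOrder _≡_ _≤_
    ⋁              : {I : Set (o ⊔ c ⊔ ℓ)} → (I → Carrier) → Carrier
    ⋁-upper        : {I : Set (o ⊔ c ⊔ ℓ)} (f : I → Carrier) (i : I) → f i ≤ ⋁ f
    ⋁-least        : {I : Set (o ⊔ c ⊔ ℓ)} (f : I → Carrier) (u : Carrier) →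
                     (∀ i → f i ≤ u) → ⋁ f ≤ u
    _⊑[_]_         : Carrier → Idx → Carrier → Set ℓ
    ⊑-isPreorder   : ∀ α → IsPreorder _≡_ (λ x y → x ⊑[ α ] y)

  _=[_]_ : Carrier → Idx → Carrier → Set ℓ
  x =[ α ] y = (x ⊑[ α ] y) × (y ⊑[ α ] x)

  IsLowerRestr : Idx → Carrier → Carrier → Set (c ⊔ ℓ)
  IsLowerRestr α x y = (x =[ α ] y) × (∀ z → x ⊑[ α ] z → y ≤ z)

  IsUpperRestr : Idx → Carrier → Carrier → Set (c ⊔ ℓ)
  IsUpperRestr α x y = (x =[ α ] y) × (∀ z → z ⊑[ α ] x → z ≤ y)

record IsStrongModel {o c ℓ : Level} {κ : LimitOrdinal o}
       (S : StratifiedCompleteLattice κ c ℓ) : Set (suc (o ⊔ c ⊔ ℓ)) where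
  open LimitOrdinal κ
  open StratifiedCompleteLattice S
  field
    A1  : ∀ {α β x y} → α < β → x ⊑[ β ] y → x =[ α ] y
    A2  : ∀ {x y} → (∀ α → x =[ α ] y) → x ≡ y
    A3  : ∀ x α → Σ Carrier (IsLowerRestr α x)
    A4* : ∀ {I : Set (o ⊔ c ⊔ ℓ)} (f g : I → Carrier) α →
          (∀ i → f i =[ α ] g i) → ⋁ f =[ α ] ⋁ g
    -- x|_α is unique, so A5 is stated for the elements characterised by A3
    A5  : ∀ {x y} α → x ≤ y → ∀ {x' y'} →
          IsLowerRestr α x x' → IsLowerRestr α y y' → x' ≤ y'
    A6  : ∀ {x y α} → x ≤ y → (∀ β → β < α → x =[ β ] y) → x ⊑[ α ] y

A3d : {o c ℓ : Level} {κ : LimitOrdinal o} → StratifiedCompleteLattice κ c ℓ → Set (o ⊔ c ⊔ ℓ)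
A3d {κ = κ} S = ∀ x (α : Idx) → Σ Carrier (IsUpperRestr α x)
  where open LimitOrdinal κ
        open StratifiedCompleteLattice S

A5d : {o c ℓ : Level} {κ : LimitOrdinal o} → StratifiedCompleteLattice κ c ℓ → Set (o ⊔ c ⊔ ℓ)
A5d {κ = κ} S = ∀ {x y} (α : Idx) → x ≤ y → ∀ {x' y'} →
                IsUpperRestr α x x' → IsUpperRestr α y y' → x' ≤ y'
  where open LimitOrdinal κ
        open StratifiedCompleteLattice S

module Submission where

-- The upper restriction is the join of the whole =α-class of x,
--     x|^α  :=  ⋁ { w | w =α x }.
-- Everything rests on one consequence of A4* for binary joins a ∨ b
-- (themselves joins of two-element families):
--   absorption up to =α:  if a =α a' and a' ≤ b, then a ∨ b =α b,
-- because a ∨ b =α a' ∨ b = b.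
-- A3d: A4* applied to the family w ↦ w and the constant family x gives
-- x|^α =α x.  If z ⊑α x then z|_α ≤ x by A3 and z =α z|_α, so absorption
-- gives z ∨ x =α x; hence z ≤ z ∨ x ≤ x|^α.
-- A5d: if x ≤ y and x' =α x, absorption gives x' ∨ y ⊑α y, so the
-- maximality of any upper restriction y' of y yields x' ≤ x' ∨ y ≤ y'.

open import Defs
open import Level using (Level; Lift; lift; _⊔_)
open import Data.Bool using (Bool; true; false)
open import Data.Product using (Σ; _×_; _,_; proj₁; proj₂)
open import Relation.Binary.PropositionalEquality using (_≡_; subst)
open import Relation.Binary.Structures using (IsPartialOrder; IsPreorder)

module StrongModelFacts {o c ℓ : Level} {κ : LimitOrdinal o}
                        (S : StratifiedCompleteLattice κ c ℓ) where
  open LimitOrdinal κ using (Idx)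
  open StratifiedCompleteLattice S
  open IsPartialOrder ≤-isPartialOrder
    using (antisym) renaming (refl to ≤-refl; trans to ≤-trans)

  =-refl : ∀ {a} α → a =[ α ] a
  =-refl α = IsPreorder.refl (⊑-isPreorder α) , IsPreorder.refl (⊑-isPreorder α)

  =-sym : ∀ {a b} α → a =[ α ] b → b =[ α ] a
  =-sym α (a⊑b , b⊑a) = b⊑a , a⊑b

  -- Binary joins are joins of two-element families; the index type is
  -- lifted to the universe over which ⋁ takes joins.
  Two : Set (o ⊔ c ⊔ ℓ)
  Two = Lift (o ⊔ c ⊔ ℓ) Bool

  pair : Carrier → Carrier → Two → Carrier
  pair a b (lift true)  = a
  pair a b (lift false) = b

  infixr 25 _∨_
  _∨_ : Carrier → Carrier → Carrier
  a ∨ b = ⋁ (pair a b)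

  ∨-upperˡ : ∀ a b → a ≤ a ∨ b
  ∨-upperˡ a b = ⋁-upper (pair a b) (lift true)

  ∨-absorb : ∀ {a b} → a ≤ b → a ∨ b ≡ b
  ∨-absorb {a} {b} a≤b =
    antisym (⋁-least (pair a b) b bounded) (⋁-upper (pair a b) (lift false))
    where
      bounded : ∀ i → pair a b i ≤ b
      bounded (lift true)  = a≤b
      bounded (lift false) = ≤-refl

  ⋁-const : ∀ {I : Set (o ⊔ c ⊔ ℓ)} (i : I) x → ⋁ {I} (λ _ → x) ≡ x
  ⋁-const i x = antisym (⋁-least _ x (λ _ → ≤-refl)) (⋁-upper (λ _ → x) i)

  module JoinCongruence
    (A4* : ∀ {I : Set (o ⊔ c ⊔ ℓ)} (f g : I → Carrier) α →
           (∀ i → f i =[ α ] g i) → ⋁ f =[ α ] ⋁ g) where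

    ∨-cong : ∀ {a a' b b'} α → a =[ α ] a' → b =[ α ] b' → a ∨ b =[ α ] a' ∨ b'
    ∨-cong {a} {a'} {b} {b'} α a=a' b=b' = A4* (pair a b) (pair a' b') α pointwise
      where
        pointwise : ∀ i → pair a b i =[ α ] pair a' b' i
        pointwise (lift true)  = a=a'
        pointwise (lift false) = b=b'

    ∨-absorb-= : ∀ {a a' b} α → a =[ α ] a' → a' ≤ b → a ∨ b =[ α ] b
    ∨-absorb-= {a} {a'} {b} α a=a' a'≤b =
      subst (λ t → a ∨ b =[ α ] t) (∨-absorb a'≤b) (∨-cong α a=a' (=-refl α))

    Class : Idx → Carrier → Set (o ⊔ c ⊔ ℓ)
    Class α x = Lift (o ⊔ c ⊔ ℓ) (Σ Carrier (λ w → w =[ α ] x))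

    member : ∀ {α x} → Class α x → Carrier
    member (lift (w , _)) = w

    upper : Idx → Carrier → Carrier
    upper α x = ⋁ (member {α} {x})

    ≤-upper : ∀ {α x w} → w =[ α ] x → w ≤ upper α x
    ≤-upper {α} {x} {w} w=x = ⋁-upper (member {α} {x}) (lift (w , w=x))

    -- x|^α =α x: compare the class with the constant family x via A4*.
    upper-= : ∀ α x → x =[ α ] upper α x
    upper-= α x =
      =-sym α (subst (λ t → upper α x =[ α ] t) (⋁-const (lift (x , =-refl α)) x)
                     (A4* (member {α} {x}) (λ _ → x) α (λ { (lift (_ , w=x)) → w=x })))

    -- A5d holds for arbitrary upper restrictions: x' ≤ x' ∨ y ⊑α y, so x' ≤ y'.
    upper-monotone : A5d S
    upper-monotone {y = y} α x≤y {x'} (x=x' , _) (_ , y'-max) =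
      ≤-trans (∨-upperˡ x' y)
              (y'-max (x' ∨ y) (proj₁ (∨-absorb-= α (=-sym α x=x') x≤y)))

    module WithLowerRestriction (A3 : ∀ x α → Σ Carrier (IsLowerRestr α x)) where

      -- Maximality of x|^α: z ⊑α x gives z ∨ x =α x, and z ≤ z ∨ x.
      upper-max : ∀ α x z → z ⊑[ α ] x → z ≤ upper α x
      upper-max α x z z⊑x = ≤-trans (∨-upperˡ z x) (≤-upper (∨-absorb-= α z=z↓ z↓≤x))
        where
          z↓ : Σ Carrier (IsLowerRestr α z)
          z↓ = A3 z α
          z=z↓ : z =[ α ] proj₁ z↓
          z=z↓ = proj₁ (proj₂ z↓)
          z↓≤x : proj₁ z↓ ≤ x
          z↓≤x = proj₂ (proj₂ z↓) x z⊑x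

      upper-restriction : A3d S
      upper-restriction x α = upper α x , upper-= α x , upper-max α x

lemma25 : {o c ℓ : Level} {κ : LimitOrdinal o} (S : StratifiedCompleteLattice κ c ℓ) →
    IsStrongModel S → A3d S × A5d S
lemma25 S M = upper-restriction , upper-monotone
  where
    open IsStrongModel M using (A3; A4*)
    open StrongModelFacts S
    open JoinCongruence A4*
    open WithLowerRestriction A3
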